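{- Let $S$ be a finite set with a closure operator $X\mapsto\overline{X}$ satisfying $\overline{\emptyset}=\emptyset$. If (1) $\mathrm{Bic}(S)$ is ordered by single-step inclusion, and (2) $W\cup\overline{(X\cup Y)\setminus W}$ is biclosed for all $W,X,Y\in\mathrm{Bic}(S)$ with $W\subseteq X\cap Y$, then $\mathrm{Bic}(S)$ is a semidistributive lattice.
   Context: A closure operator on $S$ is a map $X\mapsto\overline{X}$ on subsets of $S$ with $X\subseteq\overline{X}$, $\overline{\overline{X}}=\overline{X}$, and $X\subseteq Y\Rightarrow\overline{X}\subseteq\overline{Y}$. A subset $X$ is closed if $\overline{X}=X$, and biclosed if both $X$ and $S\setminus X$ are closed. $\mathrm{Bic}(S)$ is the poset of biclosed subsets of $S$ ordered by inclusion. A collection $\mathcal{B}$ of subsets of $S$ is ordered by single-step inclusion if for all $X,Y\in\mathcal{B}$ with $X\subsetneq Y$ there exists $y\in Y\setminus X$ with $X\cup\{y\}\in\mathcal{B}$. A lattice is meet-semidistributive if $x\wedge z=y\wedge z$ implies $(x\vee y)\wedge z=x\wedge z$, join-semidistributive if the dual condition holds, and semidistributive if both hold. -}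

module Defs where

open import Data.Nat using (ℕ)
open import Data.Fin using (Fin)
open import Data.Fin.Subset using (Subset; _∈_; _∉_; _⊆_; _∪_; _∩_; _─_; ∁; ⁅_⁆; ⊥)
open import Data.Product using (Σ; ∃; _×_; _,_)
open import Relation.Binary.PropositionalEquality using (_≡_)

record IsClosureOperator {n : ℕ} (cl : Subset n → Subset n) : Set where
  field
    extensive  : ∀ X → X ⊆ cl X
    idempotent : ∀ X → cl (cl X) ≡ cl X
    monotone   : ∀ X Y → X ⊆ Y → cl X ⊆ cl Y

module _ {n : ℕ} (cl : Subset n → Subset n) where

  IsClosed : Subset n → Set
  IsClosed X = cl X ≡ X

  IsBiclosed : Subset n → Set
  IsBiclosed X = IsClosed X × IsClosed (∁ X)

  SingleStepInclusion : Set
  SingleStepInclusion =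
    ∀ X Y → IsBiclosed X → IsBiclosed Y → X ⊆ Y → (∃ λ z → z ∈ Y × z ∉ X) →
    ∃ λ y → y ∈ Y × y ∉ X × IsBiclosed (X ∪ ⁅ y ⁆)

  IsJoinBic : Subset n → Subset n → Subset n → Set
  IsJoinBic X Y Z =
    IsBiclosed Z × X ⊆ Z × Y ⊆ Z ×
    (∀ U → IsBiclosed U → X ⊆ U → Y ⊆ U → Z ⊆ U)

  IsMeetBic : Subset n → Subset n → Subset n → Set
  IsMeetBic X Y Z =
    IsBiclosed Z × Z ⊆ X × Z ⊆ Y ×
    (∀ U → IsBiclosed U → U ⊆ X → U ⊆ Y → U ⊆ Z)

  BicIsLattice : Set
  BicIsLattice =
    ∀ X Y → IsBiclosed X → IsBiclosed Y →
    (∃ λ J → IsJoinBic X Y J) × (∃ λ M → IsMeetBic X Y M)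

  BicMeetSemidistributive : Set
  BicMeetSemidistributive =
    ∀ X Y Z M J M' → IsBiclosed X → IsBiclosed Y → IsBiclosed Z →
    IsMeetBic X Z M → IsMeetBic Y Z M →
    IsJoinBic X Y J → IsMeetBic J Z M' → M' ≡ M

  BicJoinSemidistributive : Set
  BicJoinSemidistributive =
    ∀ X Y Z J M J' → IsBiclosed X → IsBiclosed Y → IsBiclosed Z →
    IsJoinBic X Z J → IsJoinBic Y Z J →
    IsMeetBic X Y M → IsJoinBic M Z J' → J' ≡ J

  BicSemidistributiveLattice : Set
  BicSemidistributiveLattice =
    BicIsLattice × BicMeetSemidistributive × BicJoinSemidistributive

-- Write  relcl W A = W ∪ cl (A ∖ W)  for the closure of A relative to W;
-- hypothesis (2) says that relcl W (X ∪ Y) is biclosed whenever W ⊆ X ∩ Y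
-- are biclosed.
--
-- * Complementation X ↦ ∁ X is an order-reversing involution of Bic(S), so it
--   exchanges joins and meets.  Hence meets exist as soon as joins do, and
--   join-semidistributivity is the dual of meet-semidistributivity.
-- * Since cl ∅ = ∅, the empty set is biclosed, and relcl ∅ (X ∪ Y) = cl (X ∪ Y)
--   is biclosed by (2); it is the join of X and Y.
-- * Meet-semidistributivity: let M = X ∧ Z = Y ∧ Z and M' = (X ∨ Y) ∧ Z, so
--   M ⊆ M'.  If M ≠ M', single-step inclusion gives m ∈ M' ∖ M with M ∪ {m}
--   biclosed.  By (2), X ∨ Y ⊆ relcl M (X ∪ Y), and since ∁ (M ∪ {m}) is
--   closed, m ∈ relcl M (X ∪ Y) forces m ∈ X ∪ Y.  But then M ∪ {m} lies
--   below X ∧ Z or below Y ∧ Z, i.e. m ∈ M: a contradiction.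

module Submission where

open import Defs
open import Data.Nat using (ℕ)
open import Data.Fin using (Fin)
open import Data.Fin.Subset using (Subset; _⊆_; _∪_; _∩_; _─_; ⊥; ∁; _∈_; _∉_; ⁅_⁆; inside; outside)
open import Data.Vec using (_∷_)
open import Data.Vec.Base using (here; there)
open import Data.Fin.Subset.Properties
open import Data.Product using (∃; _×_; _,_; proj₁; proj₂)
open import Data.Sum using (inj₁; inj₂; [_,_])
open import Relation.Binary.PropositionalEquality using (_≡_; sym; cong; subst; subst₂)
open import Relation.Nullary using (¬_; yes; no)
open import Relation.Nullary.Decidable using (decidable-stable)
import Algebra.Lattice.Properties.BooleanAlgebra as BooleanAlgebraProperties

private
  variable
    n : ℕ
    x : Fin n
    p q r : Subset n

∁-involutive : (p : Subset n) → ∁ (∁ p) ≡ p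
∁-involutive {n} = BooleanAlgebraProperties.¬-involutive (∪-∩-booleanAlgebra n)

∁-transposeˡ : ∁ p ⊆ q → ∁ q ⊆ p
∁-transposeˡ {p = p} ∁p⊆q = subst (_ ⊆_) (∁-involutive p) (p⊆q⇒∁p⊇∁q ∁p⊆q)

∁-transposeʳ : p ⊆ ∁ q → q ⊆ ∁ p
∁-transposeʳ {q = q} p⊆∁q = subst (_⊆ _) (∁-involutive q) (p⊆q⇒∁p⊇∁q p⊆∁q)

x∈p─q⇒x∉q : (p q : Subset n) → x ∈ p ─ q → x ∉ q
x∈p─q⇒x∉q (s ∷ p) (outside ∷ q) here ()
x∈p─q⇒x∉q (s ∷ p) (inside ∷ q) () here
x∈p─q⇒x∉q (s ∷ p) (t ∷ q) (there x∈p─q) (there x∈q) = x∈p─q⇒x∉q p q x∈p─q x∈q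

∪-least : p ⊆ r → q ⊆ r → p ∪ q ⊆ r
∪-least {p = p} {q = q} p⊆r q⊆r x∈p∪q = [ p⊆r , q⊆r ] (x∈p∪q⁻ p q x∈p∪q)

⁅⁆⊆ : x ∈ p → ⁅ x ⁆ ⊆ p
⁅⁆⊆ {x = x} {p = p} x∈p y∈⁅x⁆ = subst (_∈ p) (sym (x∈⁅y⁆⇒x≡y x y∈⁅x⁆)) x∈p

-- Subsets are decidable, so q ⊆ p as soon as no element of q lies outside p.
⊆-by-no-outsider : ¬ (∃ λ z → z ∈ q × z ∉ p) → q ⊆ p
⊆-by-no-outsider {p = p} no-outsider {x} x∈q =
  decidable-stable (x ∈? p) (λ x∉p → no-outsider (x , x∈q , x∉p))

-- Complementation maps Bic(S) onto itself reversing inclusion, so it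
-- exchanges joins and meets.  Nothing about cl is used: any map cl will do.
module Duality {n : ℕ} (cl : Subset n → Subset n) where

  biclosed-∁ : {X : Subset n} → IsBiclosed cl X → IsBiclosed cl (∁ X)
  biclosed-∁ {X} (X-closed , ∁X-closed) =
    ∁X-closed , subst (IsClosed cl) (sym (∁-involutive X)) X-closed

  join⇒meet-∁ : {X Y J : Subset n} →
    IsJoinBic cl X Y J → IsMeetBic cl (∁ X) (∁ Y) (∁ J)
  join⇒meet-∁ (J-bic , X⊆J , Y⊆J , J-least) =
    biclosed-∁ J-bic , p⊆q⇒∁p⊇∁q X⊆J , p⊆q⇒∁p⊇∁q Y⊆J ,
    λ U U-bic U⊆∁X U⊆∁Y →
      ∁-transposeʳ (J-least (∁ U) (biclosed-∁ U-bic) (∁-transposeʳ U⊆∁X) (∁-transposeʳ U⊆∁Y))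

  meet⇒join-∁ : {X Y M : Subset n} →
    IsMeetBic cl X Y M → IsJoinBic cl (∁ X) (∁ Y) (∁ M)
  meet⇒join-∁ (M-bic , M⊆X , M⊆Y , M-greatest) =
    biclosed-∁ M-bic , p⊆q⇒∁p⊇∁q M⊆X , p⊆q⇒∁p⊇∁q M⊆Y ,
    λ U U-bic ∁X⊆U ∁Y⊆U →
      ∁-transposeˡ (M-greatest (∁ U) (biclosed-∁ U-bic) (∁-transposeˡ ∁X⊆U) (∁-transposeˡ ∁Y⊆U))

  meets-from-joins :
    (∀ X Y → IsBiclosed cl X → IsBiclosed cl Y → ∃ λ J → IsJoinBic cl X Y J) →
    (∀ X Y → IsBiclosed cl X → IsBiclosed cl Y → ∃ λ M → IsMeetBic cl X Y M)
  meets-from-joins join X Y X-bic Y-bic with join (∁ X) (∁ Y) (biclosed-∁ X-bic) (biclosed-∁ Y-bic)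
  ... | J , J-join =
    ∁ J , subst₂ (λ A B → IsMeetBic cl A B (∁ J)) (∁-involutive X) (∁-involutive Y) (join⇒meet-∁ J-join)

  meetSD⇒joinSD : BicMeetSemidistributive cl → BicJoinSemidistributive cl
  meetSD⇒joinSD meetSD X Y Z J M J' X-bic Y-bic Z-bic X∨Z Y∨Z X∧Y M∨Z =
    subst₂ _≡_ (∁-involutive J') (∁-involutive J) (cong ∁ ∁J'≡∁J)
    where
    ∁J'≡∁J : ∁ J' ≡ ∁ J
    ∁J'≡∁J = meetSD (∁ X) (∁ Y) (∁ Z) (∁ J) (∁ M) (∁ J')
      (biclosed-∁ X-bic) (biclosed-∁ Y-bic) (biclosed-∁ Z-bic)
      (join⇒meet-∁ X∨Z) (join⇒meet-∁ Y∨Z) (meet⇒join-∁ X∧Y) (join⇒meet-∁ M∨Z)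

meet-absorbs-atom : {cl : Subset n → Subset n} {A Z M : Subset n} {m : Fin n} →
  IsMeetBic cl A Z M → IsBiclosed cl (M ∪ ⁅ m ⁆) → m ∈ A → m ∈ Z → m ∈ M
meet-absorbs-atom {m = m} (_ , M⊆A , M⊆Z , M-greatest) M+m-bic m∈A m∈Z =
  M-greatest _ M+m-bic (∪-least M⊆A (⁅⁆⊆ m∈A)) (∪-least M⊆Z (⁅⁆⊆ m∈Z))
    (x∈p∪q⁺ (inj₂ (x∈⁅x⁆ m)))

module ClosureOperator {n : ℕ} {cl : Subset n → Subset n} (isClosure : IsClosureOperator cl) where

  open IsClosureOperator isClosure

  closure-least : {A U : Subset n} → IsClosed cl U → A ⊆ U → cl A ⊆ U
  closure-least {A} {U} U-closed A⊆U = subst (cl A ⊆_) U-closed (monotone A U A⊆U)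

  -- S = ∁ ∅ is always closed, so ∅ is biclosed once it is closed.
  ⊥-biclosed : cl ⊥ ≡ ⊥ → IsBiclosed cl ⊥
  ⊥-biclosed cl⊥≡⊥ = cl⊥≡⊥ , ⊆-antisym (λ _ → x∉p⇒x∈∁p ∉⊥) (extensive (∁ ⊥))

  relcl : Subset n → Subset n → Subset n
  relcl W A = W ∪ cl (A ─ W)

  ⊆-relcl : {W : Subset n} (A : Subset n) → A ⊆ relcl W A
  ⊆-relcl {W} A {x} x∈A with x ∈? W
  ... | yes x∈W = x∈p∪q⁺ (inj₁ x∈W)
  ... | no x∉W = x∈p∪q⁺ (inj₂ (extensive (A ─ W) (x∈p∧x∉q⇒x∈p─q x∈A x∉W)))

  ⊆-relclˡ : {W : Subset n} (X Y : Subset n) → X ⊆ relcl W (X ∪ Y)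
  ⊆-relclˡ X Y x∈X = ⊆-relcl (X ∪ Y) (p⊆p∪q Y x∈X)

  ⊆-relclʳ : {W : Subset n} (X Y : Subset n) → Y ⊆ relcl W (X ∪ Y)
  ⊆-relclʳ X Y y∈Y = ⊆-relcl (X ∪ Y) (q⊆p∪q X Y y∈Y)

  relcl-least : {W A U : Subset n} → IsClosed cl U → W ⊆ U → A ⊆ U → relcl W A ⊆ U
  relcl-least {W} {A} U-closed W⊆U A⊆U =
    ∪-least W⊆U (closure-least U-closed (λ x∈A─W → A⊆U (p─q⊆p A W x∈A─W)))

  -- If ∁ (W ∪ {m}) is closed, then relcl W A avoids every m outside W and A:
  -- A ∖ W lies in that closed set, hence so does its closure.
  relcl-avoids : {W A : Subset n} {m : Fin n} → IsClosed cl (∁ (W ∪ ⁅ m ⁆)) →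
    m ∉ W → m ∉ A → m ∉ relcl W A
  relcl-avoids {W} {A} {m} co-closed m∉W m∉A m∈relcl =
    [ m∉W , m∉cl ] (x∈p∪q⁻ W (cl (A ─ W)) m∈relcl)
    where
    A─W⊆∁W+m : A ─ W ⊆ ∁ (W ∪ ⁅ m ⁆)
    A─W⊆∁W+m {y} y∈A─W = x∉p⇒x∈∁p λ y∈W+m →
      [ x∈p─q⇒x∉q A W y∈A─W
      , (λ y∈⁅m⁆ → m∉A (subst (_∈ A) (x∈⁅y⁆⇒x≡y m y∈⁅m⁆) (p─q⊆p A W y∈A─W))) ]
      (x∈p∪q⁻ W ⁅ m ⁆ y∈W+m)
    m∉cl : m ∉ cl (A ─ W)
    m∉cl m∈cl = x∈∁p⇒x∉p (closure-least co-closed A─W⊆∁W+m m∈cl) (x∈p∪q⁺ (inj₂ (x∈⁅x⁆ m)))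

  RelativeClosureBiclosed : Set
  RelativeClosureBiclosed = ∀ W X Y → IsBiclosed cl W → IsBiclosed cl X → IsBiclosed cl Y →
    W ⊆ X ∩ Y → IsBiclosed cl (relcl W (X ∪ Y))

  module _ (relcl-biclosed : RelativeClosureBiclosed) where

    join-below-relcl : {W X Y J : Subset n} →
      IsBiclosed cl W → IsBiclosed cl X → IsBiclosed cl Y → W ⊆ X ∩ Y →
      IsJoinBic cl X Y J → J ⊆ relcl W (X ∪ Y)
    join-below-relcl {W} {X} {Y} W-bic X-bic Y-bic W⊆X∩Y (_ , _ , _ , J-least) =
      J-least _ (relcl-biclosed W X Y W-bic X-bic Y-bic W⊆X∩Y)
        (⊆-relclˡ X Y) (⊆-relclʳ X Y)

    -- With W = ∅ this bound is itself the join: cl (X ∪ Y) is biclosed.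
    joins-exist : cl ⊥ ≡ ⊥ →
      ∀ X Y → IsBiclosed cl X → IsBiclosed cl Y → ∃ λ J → IsJoinBic cl X Y J
    joins-exist cl⊥≡⊥ X Y X-bic Y-bic =
      relcl ⊥ (X ∪ Y) ,
      relcl-biclosed ⊥ X Y (⊥-biclosed cl⊥≡⊥) X-bic Y-bic (⊆-min (X ∩ Y)) ,
      ⊆-relclˡ X Y , ⊆-relclʳ X Y ,
      λ U U-bic X⊆U Y⊆U → relcl-least (proj₁ U-bic) (⊆-min U) (∪-least X⊆U Y⊆U)

    bic-lattice : cl ⊥ ≡ ⊥ → BicIsLattice cl
    bic-lattice cl⊥≡⊥ X Y X-bic Y-bic =
      joins-exist cl⊥≡⊥ X Y X-bic Y-bic ,
      Duality.meets-from-joins cl (joins-exist cl⊥≡⊥) X Y X-bic Y-bic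

    -- If M = X ∧ Z = Y ∧ Z and M' = (X ∨ Y) ∧ Z, then M ⊆ M', and single-step
    -- inclusion would produce an element m ∈ M' ∖ M with M ∪ {m} biclosed.
    -- Such m lies in X ∨ Y ⊆ relcl M (X ∪ Y), hence in X or in Y, and then
    -- meet-absorbs-atom puts it in M.
    bic-meetSD : SingleStepInclusion cl → BicMeetSemidistributive cl
    bic-meetSD single-step X Y Z M J M' X-bic Y-bic Z-bic
      X∧Z@(M-bic , M⊆X , M⊆Z , _) Y∧Z@(_ , M⊆Y , _ , _) X∨Y@(_ , X⊆J , _ , _)
      (M'-bic , M'⊆J , M'⊆Z , M'-greatest) =
      ⊆-antisym (⊆-by-no-outsider (λ outsider → no-new-atom (single-step M M' M-bic M'-bic M⊆M' outsider)))
                M⊆M'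
      where
      M⊆M' : M ⊆ M'
      M⊆M' = M'-greatest M M-bic (λ x∈M → X⊆J (M⊆X x∈M)) M⊆Z
      J⊆relcl : J ⊆ relcl M (X ∪ Y)
      J⊆relcl = join-below-relcl M-bic X-bic Y-bic (λ x∈M → x∈p∩q⁺ (M⊆X x∈M , M⊆Y x∈M)) X∨Y
      no-new-atom : ¬ (∃ λ m → m ∈ M' × m ∉ M × IsBiclosed cl (M ∪ ⁅ m ⁆))
      no-new-atom (m , m∈M' , m∉M , M+m-bic) with m ∈? X | m ∈? Y
      ... | yes m∈X | _ = m∉M (meet-absorbs-atom X∧Z M+m-bic m∈X (M'⊆Z m∈M'))
      ... | no _ | yes m∈Y = m∉M (meet-absorbs-atom Y∧Z M+m-bic m∈Y (M'⊆Z m∈M'))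
      ... | no m∉X | no m∉Y =
        relcl-avoids (proj₂ M+m-bic) m∉M
          (λ m∈X∪Y → [ m∉X , m∉Y ] (x∈p∪q⁻ X Y m∈X∪Y)) (J⊆relcl (M'⊆J m∈M'))

theorem5p2 : (n : ℕ) (cl : Subset n → Subset n) → IsClosureOperator cl →
    cl ⊥ ≡ ⊥ →
    SingleStepInclusion cl →
    (∀ W X Y → IsBiclosed cl W → IsBiclosed cl X → IsBiclosed cl Y →
      W ⊆ X ∩ Y → IsBiclosed cl (W ∪ cl ((X ∪ Y) ─ W))) →
    BicSemidistributiveLattice cl
theorem5p2 _ cl isClosure cl⊥≡⊥ single-step relcl-biclosed =
  bic-lattice relcl-biclosed cl⊥≡⊥ , meetSD , Duality.meetSD⇒joinSD cl meetSD
  where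
  open ClosureOperator isClosure
  meetSD : BicMeetSemidistributive cl
  meetSD = bic-meetSD relcl-biclosed single-step
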